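{- Let $X,Y$ be sets, $\varphi:Y\to X$ a map, and $g$ a complementary choice function on $Y$. Then the choice function $f=\varphi_*(g)$ on $X$, defined by $f(A)=\varphi\big(g(\varphi^{ -1}(A))\big)$ for $A\subseteq X$, is complementary.
   Context: A choice function (CF) on a set $Z$ is a map $h:2^Z\to 2^Z$ with $h(A)\subseteq A$ for all $A\subseteq Z$. A CF $h$ is consistent if $h(A)\subseteq B\subseteq A$ implies $h(B)=h(A)$; monotonic if $A\subseteq B$ implies $h(A)\subseteq h(B)$; complementary if it is consistent and monotonic. -}

module Defs where

open import Level using (Level)
open import Data.Product using (Σ; _×_; _,_; proj₁; proj₂)
open import Relation.Binary.PropositionalEquality using (subst)
open import Relation.Binary.PropositionalEquality using (_≡_)
open import Relation.Unary using (Pred; _⊆_; _≐_)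

-- Subsets of Z are predicates Pred Z ℓ (i.e. elements of 2^Z);
-- equality of subsets is extensional (mutual inclusion, _≐_).

-- A choice function on Z: a map h on subsets with h(A) ⊆ A for all A,
-- which respects extensional equality of subsets (it is a map on 2^Z).
record ChoiceFunction {ℓ : Level} (Z : Set ℓ) : Set (Level.suc ℓ) where
  field
    apply    : Pred Z ℓ → Pred Z ℓ
    contract : ∀ (A : Pred Z ℓ) → apply A ⊆ A
    resp-≐   : ∀ {A B : Pred Z ℓ} → A ≐ B → apply A ≐ apply B

open ChoiceFunction public

module _ {ℓ : Level} {Z : Set ℓ} (h : ChoiceFunction Z) where

  Consistent : Set (Level.suc ℓ)
  Consistent = ∀ (A B : Pred Z ℓ) → apply h A ⊆ B → B ⊆ A → apply h B ≐ apply h A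

  Monotonic : Set (Level.suc ℓ)
  Monotonic = ∀ (A B : Pred Z ℓ) → A ⊆ B → apply h A ⊆ apply h B

  Complementary : Set (Level.suc ℓ)
  Complementary = Consistent × Monotonic

module _ {ℓ : Level} {X Y : Set ℓ} where

  image : (Y → X) → Pred Y ℓ → Pred X ℓ
  image φ S x = Σ Y (λ y → S y × φ y ≡ x)

  preimage : (Y → X) → Pred X ℓ → Pred Y ℓ
  preimage φ A y = A (φ y)

  pushforwardMap : (Y → X) → ChoiceFunction Y → Pred X ℓ → Pred X ℓ
  pushforwardMap φ g A = image φ (apply g (preimage φ A))

  pushforward : (Y → X) → ChoiceFunction Y → ChoiceFunction X
  pushforward φ g = record
    { apply    = pushforwardMap φ g
    ; contract = λ A → λ { (y , gy , eq) → subst A eq (contract g (preimage φ A) gy) }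
    ; resp-≐   = λ { {A} {B} (A⊆B , B⊆A) →
                     (λ { (y , gy , eq) → y , proj₁ (resp-≐ g (A⊆B , B⊆A)) gy , eq })
                   , (λ { (y , gy , eq) → y , proj₂ (resp-≐ g (A⊆B , B⊆A)) gy , eq }) }
    }

module Submission where

-- Since φ(S) ⊆ A implies S ⊆ φ⁻¹(A), and φ⁻¹ preserves inclusions, the
-- hypotheses of consistency and monotonicity for f = φ_*(g) at A, B become
-- the same hypotheses for g at φ⁻¹(A), φ⁻¹(B); the conclusions for g then
-- transfer to f because taking images preserves ⊆ and ≐.

open import Defs
open import Level using (Level)
open import Data.Product using (_,_)
open import Relation.Binary.PropositionalEquality using (refl)
open import Relation.Unary using (Pred; _⊆_; _≐_)

module _ {ℓ : Level} {X Y : Set ℓ} (φ : Y → X) where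

  image-mono : {S T : Pred Y ℓ} → S ⊆ T → image φ S ⊆ image φ T
  image-mono S⊆T (y , Sy , φy≡x) = y , S⊆T Sy , φy≡x

  image-resp-≐ : {S T : Pred Y ℓ} → S ≐ T → image φ S ≐ image φ T
  image-resp-≐ (S⊆T , T⊆S) = image-mono S⊆T , image-mono T⊆S

  preimage-mono : {A B : Pred X ℓ} → A ⊆ B → preimage φ A ⊆ preimage φ B
  preimage-mono A⊆B = A⊆B

  image⊆⇒⊆preimage : {S : Pred Y ℓ} {A : Pred X ℓ} → image φ S ⊆ A → S ⊆ preimage φ A
  image⊆⇒⊆preimage φS⊆A Sy = φS⊆A (_ , Sy , refl)

  module _ (g : ChoiceFunction Y) where

    pushforward-consistent : Consistent g → Consistent (pushforward φ g)
    pushforward-consistent consistent A B fA⊆B B⊆A =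
      image-resp-≐ (consistent (preimage φ A) (preimage φ B)
                      (image⊆⇒⊆preimage fA⊆B) (preimage-mono {B} {A} B⊆A))

    pushforward-monotonic : Monotonic g → Monotonic (pushforward φ g)
    pushforward-monotonic monotonic A B A⊆B =
      image-mono (monotonic (preimage φ A) (preimage φ B) (preimage-mono {A} {B} A⊆B))

proposition3 : ∀ {ℓ : Level} {X Y : Set ℓ} (φ : Y → X) (g : ChoiceFunction Y)
    → Complementary g → Complementary (pushforward φ g)
proposition3 φ g (consistent , monotonic) =
  pushforward-consistent φ g consistent , pushforward-monotonic φ g monotonic
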